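{- Let $k,q\in\mathbb{Z}$ with $k\ge2$ and $q\ge2$. Let $d^{\widetilde N_k}_q$ and $d^{\widetilde Z_k}_q$ be the minimum weights of $\mathcal{N}_k(q)$ and $\mathcal{Z}_k(q)$. Then $d^{\widetilde N_k}_q=k$ if $k<4$ and $d^{\widetilde N_k}_q=4$ if $k\ge4$; and $d^{\widetilde Z_k}_q=k+1$ if $k<4$ and $d^{\widetilde Z_k}_q=4$ if $k\ge4$.
   Context: $\mathbb{Z}_q:=\mathbb{Z}/q\mathbb{Z}$. Let $I_k$ be the $k\times k$ identity matrix, $J_k$ the $k\times k$ all-ones matrix, $1_k$ the all-ones column vector. $\widetilde N_k:=(I_k\mid J_k-I_k)$, $\widetilde Z_k:=(I_k\mid J_k-I_k\mid 1_k)$, $\mathcal{N}_k(q):=\{u\widetilde N_k\mid u\in\mathbb{Z}_q^k\}$, $\mathcal{Z}_k(q):=\{u\widetilde Z_k\mid u\in\mathbb{Z}_q^k\}$. The minimum weight of a code is the minimum number of nonzero entries of a nonzero codeword. -}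

module Defs where

open import Data.Nat using (ℕ; zero; suc; _+_; _*_; _≤_; NonZero)
open import Data.Nat.DivMod using (_%_)
open import Data.Fin using (Fin; zero; suc; toℕ; splitAt; _≟_)
open import Data.Sum using (inj₁; inj₂)
open import Data.Product using (Σ; ∃; _×_)
open import Relation.Nullary using (¬_; yes; no)
open import Relation.Binary.PropositionalEquality using (_≡_)

sumFin : ∀ {n} → (Fin n → ℕ) → ℕ
sumFin {zero}  f = 0
sumFin {suc n} f = f zero + sumFin (λ i → f (suc i))

-- Elements of Z_q are represented by Fin q (residues 0..q-1).
-- Matrices with integer entries (here 0/1) as functions Fin m → Fin n → ℕ.

-- Ñ_k = (I_k | J_k - I_k), a k × 2k matrix
Ntil : (k : ℕ) → Fin k → Fin (k + k) → ℕ
Ntil k i j with splitAt k j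
... | inj₁ a with i ≟ a
...   | yes _ = 1
...   | no  _ = 0
Ntil k i j | inj₂ b with i ≟ b
...   | yes _ = 0
...   | no  _ = 1

-- Z̃_k = (I_k | J_k - I_k | 1_k), a k × (2k+1) matrix
Ztil : (k : ℕ) → Fin k → Fin (k + k + 1) → ℕ
Ztil k i j with splitAt (k + k) j
... | inj₁ a = Ntil k i a
... | inj₂ _ = 1

codeword : (q : ℕ) .{{_ : NonZero q}} → ∀ {k n} →
           (Fin k → Fin n → ℕ) → (Fin k → Fin q) → Fin n → ℕ
codeword q M u j = sumFin (λ i → toℕ (u i) * M i j) % q

weight : ∀ {n} → (Fin n → ℕ) → ℕ
weight {zero}  c = 0
weight {suc n} c with c zero
... | zero  = weight (λ i → c (suc i))
... | suc _ = suc (weight (λ i → c (suc i)))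

NonZeroWord : ∀ {n} → (Fin n → ℕ) → Set
NonZeroWord {n} c = ∃ λ (j : Fin n) → ¬ (c j ≡ 0)

MinWeight : (q : ℕ) .{{_ : NonZero q}} → ∀ {k n} →
            (Fin k → Fin n → ℕ) → ℕ → Set
MinWeight q {k} M d =
  (Σ (Fin k → Fin q) λ u → NonZeroWord (codeword q M u) × weight (codeword q M u) ≡ d)
  × (∀ (u : Fin k → Fin q) → NonZeroWord (codeword q M u) → d ≤ weight (codeword q M u))

{-# OPTIONS --safe #-}
module Submission where

-- Write x for the residues of a message u and t = Σ xᵢ. Coordinates i and k + i of
-- uÑ_k are xᵢ and t − xᵢ (mod q), and uZ̃_k appends t. If t ≢ 0 (mod q) the two
-- coordinates of a pair never both vanish, so wt(uÑ_k) ≥ k and wt(uZ̃_k) ≥ k + 1.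
-- If t ≡ 0 they are xᵢ and −xᵢ, so wt(uÑ_k) = wt(uZ̃_k) = 2 wt(u), and wt(u) ≥ 2
-- since a single nonzero residue cannot sum to 0. The messages e₀ and e₀ − e₁
-- attain these bounds.

open import Defs
open import Data.Nat using (ℕ; zero; suc; _+_; _*_; _∸_; _≤_; _<_; _⊓_; NonZero; z≤n; s≤s; z<s; >-nonZero⁻¹)
open import Data.Nat.Properties
open import Data.Nat.DivMod using (_%_; m<n⇒m%n≡m; n%n≡0; %-remove-+ˡ; %-remove-+ʳ)
open import Data.Nat.Divisibility using (m%n≡0⇒n∣m)
open import Data.Fin using (Fin; zero; suc; toℕ; fromℕ; punchIn; punchOut; _↑ˡ_; _↑ʳ_) renaming (_≟_ to _≟ᶠ_)
open import Data.Fin.Properties using (splitAt-↑ˡ; splitAt-↑ʳ; ¬∀⟶∃¬; toℕ<n; toℕ-fromℕ; punchInᵢ≢i; punchIn-punchOut)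
open import Data.Vec.Functional using (removeAt)
open import Data.Sum using (_⊎_; inj₁; inj₂)
open import Data.Product using (_×_; _,_; ∃-syntax)
open import Function using (_∘_)
open import Relation.Nullary using (¬_; yes; no; contradiction)
open import Relation.Nullary.Decidable using (_⊎-dec_)
open import Relation.Binary.PropositionalEquality
open import Algebra.Properties.Semiring.Sum +-*-semiring
  using (sum; sum-cong-≗; ∑-distrib-+; sum-remove; sum-replicate-zero; *-distribˡ-sum)

sumFin≡sum : ∀ {n} (f : Fin n → ℕ) → sumFin f ≡ sum f
sumFin≡sum {zero}  f = refl
sumFin≡sum {suc n} f = cong (f zero +_) (sumFin≡sum (f ∘ suc))

sum-↑ˡ-↑ʳ : ∀ m {n} (f : Fin (m + n) → ℕ) → sum f ≡ sum (f ∘ (_↑ˡ n)) + sum (f ∘ (m ↑ʳ_))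
sum-↑ˡ-↑ʳ zero    f = refl
sum-↑ˡ-↑ʳ (suc m) f = trans (cong (f zero +_) (sum-↑ˡ-↑ʳ m (f ∘ suc))) (sym (+-assoc (f zero) _ _))

sum-replicate-1 : ∀ n → sum {n} (λ _ → 1) ≡ n
sum-replicate-1 zero    = refl
sum-replicate-1 (suc n) = cong suc (sum-replicate-1 n)

sum-supportedAt : ∀ {n} (f : Fin n → ℕ) {b} → (∀ i → i ≢ b → f i ≡ 0) → sum f ≡ f b
sum-supportedAt {suc n} f {b} f≡0 = begin
  sum f                    ≡⟨ sum-remove {i = b} f ⟩
  f b + sum (removeAt f b) ≡⟨ cong (f b +_) (sum-cong-≗ (λ j → f≡0 _ (punchInᵢ≢i b j))) ⟩
  f b + sum {n} (λ _ → 0)  ≡⟨ cong (f b +_) (sum-replicate-zero n) ⟩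
  f b + 0                  ≡⟨ +-identityʳ (f b) ⟩
  f b                      ∎
  where open ≡-Reasoning

sum-agreeingOff : ∀ {n} (f g : Fin n → ℕ) i → f i ≡ 0 → (∀ j → j ≢ i → f j ≡ g j) →
                  sum f + g i ≡ sum g
sum-agreeingOff {suc n} f g i fᵢ≡0 f≡g = begin
  sum f + g i                      ≡⟨ cong (_+ g i) (sum-remove {i = i} f) ⟩
  (f i + sum (removeAt f i)) + g i ≡⟨ cong₂ (λ a b → (a + b) + g i) fᵢ≡0 (sum-cong-≗ (λ j → f≡g _ (punchInᵢ≢i i j))) ⟩
  sum (removeAt g i) + g i         ≡⟨ +-comm _ (g i) ⟩
  g i + sum (removeAt g i)         ≡⟨ sum-remove {i = i} g ⟨
  sum g                            ∎
  where open ≡-Reasoning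

≤-sum : ∀ {n} (f : Fin n → ℕ) i → f i ≤ sum f
≤-sum {suc n} f i = ≤-trans (m≤m+n (f i) _) (≤-reflexive (sym (sum-remove {i = i} f)))

+-≤-sum : ∀ {n} (f : Fin n → ℕ) {i j} → i ≢ j → f i + f j ≤ sum f
+-≤-sum {suc n} f {i} {j} i≢j = begin
  f i + f j                         ≡⟨ cong (λ j′ → f i + f j′) (punchIn-punchOut i≢j) ⟨
  f i + removeAt f i (punchOut i≢j) ≤⟨ +-monoʳ-≤ (f i) (≤-sum (removeAt f i) _) ⟩
  f i + sum (removeAt f i)          ≡⟨ sum-remove {i = i} f ⟨
  sum f                             ∎
  where open ≤-Reasoning

n≤sum : ∀ {n} (f : Fin n → ℕ) → (∀ i → 1 ≤ f i) → n ≤ sum f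
n≤sum {zero}  f 1≤f = z≤n
n≤sum {suc n} f 1≤f = +-mono-≤ (1≤f zero) (n≤sum (f ∘ suc) (1≤f ∘ suc))

sgn : ℕ → ℕ
sgn zero    = 0
sgn (suc _) = 1

sgn-≢0 : ∀ {n} → n ≢ 0 → sgn n ≡ 1
sgn-≢0 {zero}  0≢0 = contradiction refl 0≢0
sgn-≢0 {suc n} _   = refl

sgn-cong-≡0 : ∀ {m n} → (m ≡ 0 → n ≡ 0) → (n ≡ 0 → m ≡ 0) → sgn m ≡ sgn n
sgn-cong-≡0 {zero}  {zero}  _   _   = refl
sgn-cong-≡0 {zero}  {suc _} m⇒n _   = contradiction (m⇒n refl) λ ()
sgn-cong-≡0 {suc _} {zero}  _   n⇒m = contradiction (n⇒m refl) λ ()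
sgn-cong-≡0 {suc _} {suc _} _   _   = refl

weight≡sum-sgn : ∀ {n} (c : Fin n → ℕ) → weight c ≡ sum (sgn ∘ c)
weight≡sum-sgn {zero}  c = refl
weight≡sum-sgn {suc n} c with c zero
... | zero  = weight≡sum-sgn (c ∘ suc)
... | suc _ = cong suc (weight≡sum-sgn (c ∘ suc))

0<weight⇒nonZeroWord : ∀ {n} (c : Fin n → ℕ) → 0 < weight c → NonZeroWord c
0<weight⇒nonZeroWord {suc n} c 0<w with c zero in c₀≡
... | suc _ = zero , λ c₀≡0 → contradiction (trans (sym c₀≡) c₀≡0) λ ()
... | zero  with j , cⱼ≢0 ← 0<weight⇒nonZeroWord (c ∘ suc) 0<w = suc j , cⱼ≢0

module _ {q : ℕ} .{{_ : NonZero q}} where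

  0%q≡0 : 0 % q ≡ 0
  0%q≡0 = m<n⇒m%n≡m (>-nonZero⁻¹ q)

  sgn%-pair-≥1 : ∀ m n → (m + n) % q ≢ 0 → 1 ≤ sgn (m % q) + sgn (n % q)
  sgn%-pair-≥1 m n [m+n]≢0 with m % q ≟ 0
  ... | no m≢0  = ≤-trans (≤-reflexive (sym (sgn-≢0 m≢0))) (m≤m+n _ _)
  ... | yes m≡0 = ≤-trans (≤-reflexive (sym (sgn-≢0 n≢0))) (m≤n+m _ _)
    where
    n≢0 : n % q ≢ 0
    n≢0 n≡0 = [m+n]≢0 (trans (%-remove-+ʳ m (m%n≡0⇒n∣m n q n≡0)) m≡0)

  sgn%-pair≡2*sgn : ∀ m n → (m + n) % q ≡ 0 → sgn (m % q) + sgn (n % q) ≡ 2 * sgn (m % q)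
  sgn%-pair≡2*sgn m n [m+n]≡0 = begin
    sgn (m % q) + sgn (n % q)       ≡⟨ cong (sgn (m % q) +_) (sgn-cong-≡0 m≡0⇒n≡0 n≡0⇒m≡0) ⟨
    sgn (m % q) + sgn (m % q)       ≡⟨ cong (sgn (m % q) +_) (+-identityʳ _) ⟨
    2 * sgn (m % q)                 ∎
    where
    open ≡-Reasoning
    m≡0⇒n≡0 : m % q ≡ 0 → n % q ≡ 0
    m≡0⇒n≡0 m≡0 = trans (sym (%-remove-+ˡ n (m%n≡0⇒n∣m m q m≡0))) [m+n]≡0
    n≡0⇒m≡0 : n % q ≡ 0 → m % q ≡ 0
    n≡0⇒m≡0 n≡0 = trans (sym (%-remove-+ʳ m (m%n≡0⇒n∣m n q n≡0))) [m+n]≡0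

  sgn%-pair≡1 : ∀ m n → (m + n) % q ≢ 0 → m ≡ 0 ⊎ n ≡ 0 → sgn (m % q) + sgn (n % q) ≡ 1
  sgn%-pair≡1 m n [m+n]≢0 (inj₁ refl) = cong₂ _+_ (cong sgn 0%q≡0) (sgn-≢0 [m+n]≢0)
  sgn%-pair≡1 m n [m+n]≢0 (inj₂ refl) =
    cong₂ _+_ (sgn-≢0 ([m+n]≢0 ∘ trans (cong (_% q) (+-identityʳ m)))) (cong sgn 0%q≡0)

Ntil-↑ˡ-diag : ∀ {k} (i : Fin k) → Ntil k i (i ↑ˡ k) ≡ 1
Ntil-↑ˡ-diag {k} i rewrite splitAt-↑ˡ k i k with i ≟ᶠ i
... | yes _   = refl
... | no  i≢i = contradiction refl i≢i

Ntil-↑ʳ-diag : ∀ {k} (i : Fin k) → Ntil k i (k ↑ʳ i) ≡ 0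
Ntil-↑ʳ-diag {k} i rewrite splitAt-↑ʳ k k i with i ≟ᶠ i
... | yes _   = refl
... | no  i≢i = contradiction refl i≢i

module _ {k : ℕ} {i j : Fin k} (i≢j : i ≢ j) where

  Ntil-↑ˡ-≢ : Ntil k i (j ↑ˡ k) ≡ 0
  Ntil-↑ˡ-≢ rewrite splitAt-↑ˡ k j k with i ≟ᶠ j
  ... | yes i≡j = contradiction i≡j i≢j
  ... | no  _   = refl

  Ntil-↑ʳ-≢ : Ntil k i (k ↑ʳ j) ≡ 1
  Ntil-↑ʳ-≢ rewrite splitAt-↑ʳ k k j with i ≟ᶠ j
  ... | yes i≡j = contradiction i≡j i≢j
  ... | no  _   = refl

Ztil-↑ˡ : ∀ {k} i (j : Fin (k + k)) → Ztil k i (j ↑ˡ 1) ≡ Ntil k i j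
Ztil-↑ˡ {k} i j rewrite splitAt-↑ˡ (k + k) j 1 = refl

Ztil-↑ʳ : ∀ {k} i (j : Fin 1) → Ztil k i ((k + k) ↑ʳ j) ≡ 1
Ztil-↑ʳ {k} i j rewrite splitAt-↑ʳ (k + k) 1 j = refl

module _ {q : ℕ} .{{_ : NonZero q}} {k : ℕ} where

  codeword≡sum : ∀ {n} (M : Fin k → Fin n → ℕ) (u : Fin k → Fin q) (j : Fin n) →
                 codeword q M u j ≡ sum (λ i → toℕ (u i) * M i j) % q
  codeword≡sum M u j = cong (_% q) (sumFin≡sum {k} _)

  codeword-cong : ∀ {n n′} (M : Fin k → Fin n → ℕ) (M′ : Fin k → Fin n′ → ℕ) u {j j′} →
                  (∀ i → M i j ≡ M′ i j′) → codeword q M u j ≡ codeword q M′ u j′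
  codeword-cong M M′ u {j} {j′} Mj≡M′j′ = begin
    codeword q M u j                        ≡⟨ codeword≡sum M u j ⟩
    sum (λ i → toℕ (u i) * M i j) % q       ≡⟨ cong (_% q) (sum-cong-≗ (λ i → cong (toℕ (u i) *_) (Mj≡M′j′ i))) ⟩
    sum (λ i → toℕ (u i) * M′ i j′) % q     ≡⟨ codeword≡sum M′ u j′ ⟨
    codeword q M′ u j′                      ∎
    where open ≡-Reasoning

  nonZeroWord⇒nonZeroMessage : ∀ {n} (M : Fin k → Fin n → ℕ) (u : Fin k → Fin q) →
                               NonZeroWord (codeword q M u) → ∃[ i ] toℕ (u i) ≢ 0
  nonZeroWord⇒nonZeroMessage M u (j , cⱼ≢0) = ¬∀⟶∃¬ k _ (λ i → toℕ (u i) ≟ 0) λ u≡0 → cⱼ≢0 (begin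
    codeword q M u j                    ≡⟨ codeword≡sum M u j ⟩
    sum (λ i → toℕ (u i) * M i j) % q   ≡⟨ cong (_% q) (sum-cong-≗ (λ i → cong (_* M i j) (u≡0 i))) ⟩
    sum {k} (λ _ → 0) % q               ≡⟨ cong (_% q) (sum-replicate-zero k) ⟩
    0 % q                               ≡⟨ 0%q≡0 ⟩
    0                                   ∎)
    where open ≡-Reasoning

module Message {q : ℕ} .{{_ : NonZero q}} {k : ℕ} (u : Fin k → Fin q) where

  x : Fin k → ℕ
  x = toℕ ∘ u

  total : ℕ
  total = sum x

  rest : Fin k → ℕ
  rest i = total ∸ x i

  wordN : Fin (k + k) → ℕ
  wordN = codeword q (Ntil k) u

  wordZ : Fin (k + k + 1) → ℕ
  wordZ = codeword q (Ztil k) u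

  x%q≡x : ∀ i → x i % q ≡ x i
  x%q≡x i = m<n⇒m%n≡m (toℕ<n (u i))

  [x+rest]%q≡total%q : ∀ i → (x i + rest i) % q ≡ total % q
  [x+rest]%q≡total%q i = cong (_% q) (m+[n∸m]≡n (≤-sum x i))

  wordN-↑ˡ : ∀ i → wordN (i ↑ˡ k) ≡ x i % q
  wordN-↑ˡ i = begin
    wordN (i ↑ˡ k)              ≡⟨ codeword≡sum (Ntil k) u (i ↑ˡ k) ⟩
    sum column % q              ≡⟨ cong (_% q) (sum-supportedAt column column≡0) ⟩
    x i * Ntil k i (i ↑ˡ k) % q ≡⟨ cong (λ e → x i * e % q) (Ntil-↑ˡ-diag i) ⟩
    x i * 1 % q                 ≡⟨ cong (_% q) (*-identityʳ (x i)) ⟩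
    x i % q                     ∎
    where
    open ≡-Reasoning
    column : Fin k → ℕ
    column j = x j * Ntil k j (i ↑ˡ k)
    column≡0 : ∀ j → j ≢ i → column j ≡ 0
    column≡0 j j≢i = trans (cong (x j *_) (Ntil-↑ˡ-≢ j≢i)) (*-zeroʳ (x j))

  wordN-↑ʳ : ∀ i → wordN (k ↑ʳ i) ≡ rest i % q
  wordN-↑ʳ i = begin
    wordN (k ↑ʳ i)               ≡⟨ codeword≡sum (Ntil k) u (k ↑ʳ i) ⟩
    sum column % q               ≡⟨ cong (_% q) (m+n∸n≡m (sum column) (x i)) ⟨
    (sum column + x i ∸ x i) % q ≡⟨ cong (λ t → (t ∸ x i) % q) (sum-agreeingOff column x i columnᵢ≡0 column≡x) ⟩
    rest i % q                   ∎
    where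
    open ≡-Reasoning
    column : Fin k → ℕ
    column j = x j * Ntil k j (k ↑ʳ i)
    columnᵢ≡0 : column i ≡ 0
    columnᵢ≡0 = trans (cong (x i *_) (Ntil-↑ʳ-diag i)) (*-zeroʳ (x i))
    column≡x : ∀ j → j ≢ i → column j ≡ x j
    column≡x j j≢i = trans (cong (x j *_) (Ntil-↑ʳ-≢ j≢i)) (*-identityʳ (x j))

  pairWeight : Fin k → ℕ
  pairWeight i = sgn (x i % q) + sgn (rest i % q)

  weightN≡sum-pairWeight : weight wordN ≡ sum pairWeight
  weightN≡sum-pairWeight = begin
    weight wordN                 ≡⟨ weight≡sum-sgn wordN ⟩
    sum (sgn ∘ wordN)            ≡⟨ sum-↑ˡ-↑ʳ k (sgn ∘ wordN) ⟩
    sum left + sum right         ≡⟨ ∑-distrib-+ left right ⟨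
    sum (λ i → left i + right i) ≡⟨ sum-cong-≗ (λ i → cong₂ _+_ (cong sgn (wordN-↑ˡ i)) (cong sgn (wordN-↑ʳ i))) ⟩
    sum pairWeight               ∎
    where
    open ≡-Reasoning
    left right : Fin k → ℕ
    left  i = sgn (wordN (i ↑ˡ k))
    right i = sgn (wordN (k ↑ʳ i))

  k≤weightN : total % q ≢ 0 → k ≤ weight wordN
  k≤weightN total≢0 = subst (k ≤_) (sym weightN≡sum-pairWeight) (n≤sum pairWeight 1≤pairWeight)
    where
    1≤pairWeight : ∀ i → 1 ≤ pairWeight i
    1≤pairWeight i = sgn%-pair-≥1 (x i) (rest i) (total≢0 ∘ trans (sym ([x+rest]%q≡total%q i)))

  weightN≡2*weight-x : total % q ≡ 0 → weight wordN ≡ 2 * weight x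
  weightN≡2*weight-x total≡0 = begin
    weight wordN              ≡⟨ weightN≡sum-pairWeight ⟩
    sum pairWeight            ≡⟨ sum-cong-≗ pairWeight≡2*sgn ⟩
    sum (λ i → 2 * sgn (x i)) ≡⟨ *-distribˡ-sum 2 (sgn ∘ x) ⟨
    2 * sum (sgn ∘ x)         ≡⟨ cong (2 *_) (weight≡sum-sgn x) ⟨
    2 * weight x              ∎
    where
    open ≡-Reasoning
    pairWeight≡2*sgn : ∀ i → pairWeight i ≡ 2 * sgn (x i)
    pairWeight≡2*sgn i = trans (sgn%-pair≡2*sgn (x i) (rest i) (trans ([x+rest]%q≡total%q i) total≡0))
                               (cong (λ r → 2 * sgn r) (x%q≡x i))

  anotherNonZero : total % q ≡ 0 → ∀ {a} → x a ≢ 0 → ∃[ b ] a ≢ b × x b ≢ 0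
  anotherNonZero total≡0 {a} xₐ≢0 with ¬∀⟶∃¬ k (λ b → a ≡ b ⊎ x b ≡ 0) (λ b → a ≟ᶠ b ⊎-dec x b ≟ 0) ¬onlyA
    where
    ¬onlyA : ¬ (∀ b → a ≡ b ⊎ x b ≡ 0)
    ¬onlyA onlyA = xₐ≢0 (begin
      x a       ≡⟨ x%q≡x a ⟨
      x a % q   ≡⟨ cong (_% q) (sum-supportedAt x othersZero) ⟨
      total % q ≡⟨ total≡0 ⟩
      0         ∎)
      where
      open ≡-Reasoning
      othersZero : ∀ b → b ≢ a → x b ≡ 0
      othersZero b b≢a with onlyA b
      ... | inj₁ a≡b  = contradiction (sym a≡b) b≢a
      ... | inj₂ xb≡0 = xb≡0
  ... | b , ¬[a≡b⊎xb≡0] = b , ¬[a≡b⊎xb≡0] ∘ inj₁ , ¬[a≡b⊎xb≡0] ∘ inj₂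

  2≤weight-x : total % q ≡ 0 → ∀ {a} → x a ≢ 0 → 2 ≤ weight x
  2≤weight-x total≡0 {a} xₐ≢0 with b , a≢b , x_b≢0 ← anotherNonZero total≡0 xₐ≢0 = begin
    2                     ≡⟨ cong₂ _+_ (sgn-≢0 xₐ≢0) (sgn-≢0 x_b≢0) ⟨
    sgn (x a) + sgn (x b) ≤⟨ +-≤-sum (sgn ∘ x) a≢b ⟩
    sum (sgn ∘ x)         ≡⟨ weight≡sum-sgn x ⟨
    weight x              ∎
    where open ≤-Reasoning

  4≤weightN : total % q ≡ 0 → ∀ {a} → x a ≢ 0 → 4 ≤ weight wordN
  4≤weightN total≡0 xₐ≢0 =
    subst (4 ≤_) (sym (weightN≡2*weight-x total≡0)) (*-monoʳ-≤ 2 (2≤weight-x total≡0 xₐ≢0))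

  k⊓4≤weightN : NonZeroWord wordN → k ⊓ 4 ≤ weight wordN
  k⊓4≤weightN nz with total % q ≟ 0 | nonZeroWord⇒nonZeroMessage (Ntil k) u nz
  ... | no  total≢0 | _         = ≤-trans (m⊓n≤m k 4) (k≤weightN total≢0)
  ... | yes total≡0 | _ , xₐ≢0 = ≤-trans (m⊓n≤n k 4) (4≤weightN total≡0 xₐ≢0)

  weightZ≡weightN+sgn : weight wordZ ≡ weight wordN + sgn (total % q)
  weightZ≡weightN+sgn = begin
    weight wordZ                                                      ≡⟨ weight≡sum-sgn wordZ ⟩
    sum (sgn ∘ wordZ)                                                 ≡⟨ sum-↑ˡ-↑ʳ (k + k) (sgn ∘ wordZ) ⟩
    sum (sgn ∘ wordZ ∘ (_↑ˡ 1)) + (sgn (wordZ ((k + k) ↑ʳ zero)) + 0) ≡⟨ cong₂ _+_ (sum-cong-≗ (cong sgn ∘ wordZ-↑ˡ)) (+-identityʳ _) ⟩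
    sum (sgn ∘ wordN) + sgn (wordZ ((k + k) ↑ʳ zero))                 ≡⟨ cong₂ _+_ (sym (weight≡sum-sgn wordN)) (cong sgn wordZ-last) ⟩
    weight wordN + sgn (total % q)                                    ∎
    where
    open ≡-Reasoning
    wordZ-↑ˡ : ∀ j → wordZ (j ↑ˡ 1) ≡ wordN j
    wordZ-↑ˡ j = codeword-cong (Ztil k) (Ntil k) u (λ i → Ztil-↑ˡ i j)
    wordZ-last : wordZ ((k + k) ↑ʳ zero) ≡ total % q
    wordZ-last = trans (codeword≡sum (Ztil k) u _)
                       (cong (_% q) (sum-cong-≗ (λ i → trans (cong (x i *_) (Ztil-↑ʳ i zero)) (*-identityʳ (x i)))))

  [k+1]⊓4≤weightZ : NonZeroWord wordZ → (k + 1) ⊓ 4 ≤ weight wordZ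
  [k+1]⊓4≤weightZ nz with total % q ≟ 0 | nonZeroWord⇒nonZeroMessage (Ztil k) u nz
  ... | no total≢0 | _ = ≤-trans (m⊓n≤m (k + 1) 4) (begin
    k + 1                          ≤⟨ +-mono-≤ (k≤weightN total≢0) (≤-reflexive (sym (sgn-≢0 total≢0))) ⟩
    weight wordN + sgn (total % q) ≡⟨ weightZ≡weightN+sgn ⟨
    weight wordZ                   ∎)
    where open ≤-Reasoning
  ... | yes total≡0 | _ , xₐ≢0 = ≤-trans (m⊓n≤n (k + 1) 4) (begin
    4                              ≤⟨ 4≤weightN total≡0 xₐ≢0 ⟩
    weight wordN                   ≤⟨ m≤m+n (weight wordN) _ ⟩
    weight wordN + sgn (total % q) ≡⟨ weightZ≡weightN+sgn ⟨
    weight wordZ                   ∎)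
    where open ≤-Reasoning

  weightZ≡2*weight-x : total % q ≡ 0 → weight wordZ ≡ 2 * weight x
  weightZ≡2*weight-x total≡0 = begin
    weight wordZ                   ≡⟨ weightZ≡weightN+sgn ⟩
    weight wordN + sgn (total % q) ≡⟨ cong₂ _+_ (weightN≡2*weight-x total≡0) (cong sgn total≡0) ⟩
    2 * weight x + 0               ≡⟨ +-identityʳ _ ⟩
    2 * weight x                   ∎
    where open ≡-Reasoning

  module SupportedAt {a} (xₐ≢0 : x a ≢ 0) (x≡0 : ∀ i → i ≢ a → x i ≡ 0) where

    total≡xₐ : total ≡ x a
    total≡xₐ = sum-supportedAt x x≡0

    total%q≢0 : total % q ≢ 0
    total%q≢0 = xₐ≢0 ∘ trans (sym (trans (cong (_% q) total≡xₐ) (x%q≡x a)))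

    weightN≡k : weight wordN ≡ k
    weightN≡k = begin
      weight wordN       ≡⟨ weightN≡sum-pairWeight ⟩
      sum pairWeight     ≡⟨ sum-cong-≗ pairWeight≡1 ⟩
      sum {k} (λ _ → 1)  ≡⟨ sum-replicate-1 k ⟩
      k                  ∎
      where
      open ≡-Reasoning
      x≡0⊎rest≡0 : ∀ i → x i ≡ 0 ⊎ rest i ≡ 0
      x≡0⊎rest≡0 i with i ≟ᶠ a
      ... | no  i≢a  = inj₁ (x≡0 i i≢a)
      ... | yes refl = inj₂ (trans (cong (_∸ x a) total≡xₐ) (n∸n≡0 (x a)))
      pairWeight≡1 : ∀ i → pairWeight i ≡ 1
      pairWeight≡1 i = sgn%-pair≡1 (x i) (rest i) (total%q≢0 ∘ trans (sym ([x+rest]%q≡total%q i))) (x≡0⊎rest≡0 i)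

    weightZ≡k+1 : weight wordZ ≡ k + 1
    weightZ≡k+1 = trans weightZ≡weightN+sgn (cong₂ _+_ weightN≡k (sgn-≢0 total%q≢0))

e₀ : ∀ {k q} → Fin (suc k) → Fin (suc (suc q))
e₀ zero    = suc zero
e₀ (suc _) = zero

e₀-supportedAt0 : ∀ {k q} (i : Fin (suc k)) → i ≢ zero → toℕ (e₀ {k} {q} i) ≡ 0
e₀-supportedAt0 zero    0≢0 = contradiction refl 0≢0
e₀-supportedAt0 (suc _) _   = refl

-- fromℕ (suc q) is the residue −1.
e₀-e₁ : ∀ {k q} → Fin (suc (suc k)) → Fin (suc (suc q))
e₀-e₁ zero                = suc zero
e₀-e₁ {q = q} (suc zero)  = fromℕ (suc q)
e₀-e₁ (suc (suc _))       = zero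

module _ {k q : ℕ} where
  open Message (e₀-e₁ {k} {q})

  e₀-e₁-total%q≡0 : total % suc (suc q) ≡ 0
  e₀-e₁-total%q≡0 = trans (cong (_% suc (suc q)) total≡q) (n%n≡0 (suc (suc q)))
    where
    open ≡-Reasoning
    total≡q : total ≡ suc (suc q)
    total≡q = begin
      1 + (toℕ (fromℕ (suc q)) + sum {k} (λ _ → 0)) ≡⟨ cong₂ (λ a b → 1 + (a + b)) (toℕ-fromℕ (suc q)) (sum-replicate-zero k) ⟩
      1 + (suc q + 0)                               ≡⟨ cong suc (+-identityʳ (suc q)) ⟩
      suc (suc q)                                   ∎

  e₀-e₁-weight≡2 : weight x ≡ 2
  e₀-e₁-weight≡2 = cong (2 +_) (trans (weight≡sum-sgn {k} (λ _ → 0)) (sum-replicate-zero k))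

  e₀-e₁-weightN≡4 : weight wordN ≡ 4
  e₀-e₁-weightN≡4 = trans (weightN≡2*weight-x e₀-e₁-total%q≡0) (cong (2 *_) e₀-e₁-weight≡2)

  e₀-e₁-weightZ≡4 : weight wordZ ≡ 4
  e₀-e₁-weightZ≡4 = trans (weightZ≡2*weight-x e₀-e₁-total%q≡0) (cong (2 *_) e₀-e₁-weight≡2)

minWeight-attained : ∀ {q} .{{_ : NonZero q}} {k n} (M : Fin k → Fin n → ℕ) {d} u → 0 < d →
                     weight (codeword q M u) ≡ d →
                     (∀ v → NonZeroWord (codeword q M v) → d ≤ weight (codeword q M v)) →
                     MinWeight q M d
minWeight-attained M u 0<d wt≡d lower = (u , 0<weight⇒nonZeroWord _ (subst (0 <_) (sym wt≡d) 0<d) , wt≡d) , lower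

corollary5p2 : (k q : ℕ) .{{_ : NonZero q}} → 2 ≤ k → 2 ≤ q →
    ((k < 4 → MinWeight q (Ntil k) k) × (4 ≤ k → MinWeight q (Ntil k) 4))
    × ((k < 4 → MinWeight q (Ztil k) (k + 1)) × (4 ≤ k → MinWeight q (Ztil k) 4))
corollary5p2 k@(suc (suc k′)) q@(suc (suc q′)) (s≤s (s≤s z≤n)) (s≤s (s≤s z≤n)) =
  ( (λ k<4 → minWeight-attained (Ntil k) e₀ z<s E₀.weightN≡k
               (lowerN (⊓-glb ≤-refl (<⇒≤ k<4))))
  , (λ 4≤k → minWeight-attained (Ntil k) e₀-e₁ z<s (e₀-e₁-weightN≡4 {k′} {q′})
               (lowerN (⊓-glb 4≤k ≤-refl))) )
  , ( (λ k<4 → minWeight-attained (Ztil k) e₀ z<s E₀.weightZ≡k+1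
                 (lowerZ (⊓-glb ≤-refl (subst (_≤ 4) (+-comm 1 k) k<4))))
    , (λ 4≤k → minWeight-attained (Ztil k) e₀-e₁ z<s (e₀-e₁-weightZ≡4 {k′} {q′})
                 (lowerZ (⊓-glb (m≤n⇒m≤n+o 1 4≤k) ≤-refl))) )
  where
  module E₀ = Message.SupportedAt e₀ {zero} (λ ()) e₀-supportedAt0

  lowerN : ∀ {d} → d ≤ k ⊓ 4 → ∀ v → NonZeroWord (codeword q (Ntil k) v) → d ≤ weight (codeword q (Ntil k) v)
  lowerN d≤ v = ≤-trans d≤ ∘ Message.k⊓4≤weightN v

  lowerZ : ∀ {d} → d ≤ (k + 1) ⊓ 4 → ∀ v → NonZeroWord (codeword q (Ztil k) v) → d ≤ weight (codeword q (Ztil k) v)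
  lowerZ d≤ v = ≤-trans d≤ ∘ Message.[k+1]⊓4≤weightZ v
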